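{- For every prime $p\ge 7$, $N_{=}(4p)\ge p^2+11p-1$.
   Context: All graphs are finite, undirected and simple. For a positive integer $k$, $N_{=}(k)$ denotes the smallest positive integer $n$ such that every graph on $n$ vertices contains an induced regular subgraph with exactly $k$ vertices. -}

module Defs where

open import Data.Nat using (ℕ; zero; suc; _+_; _≤_)
open import Data.Bool using (Bool; true; false; if_then_else_)
open import Data.Fin using (Fin)
open import Data.Product using (Σ; ∃; _×_)
open import Function.Definitions using (Injective)
open import Relation.Binary.PropositionalEquality using (_≡_)

record Graph (n : ℕ) : Set where
  field
    adj   : Fin n → Fin n → Bool
    sym   : ∀ i j → adj i j ≡ adj j i
    irrefl : ∀ i → adj i i ≡ false
open Graph public

countTrue : ∀ {n} → (Fin n → Bool) → ℕ
countTrue {zero}  f = zero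
countTrue {suc n} f = (if f Fin.zero then 1 else 0) + countTrue {n} (λ i → f (Fin.suc i))

degree : ∀ {n} → Graph n → Fin n → ℕ
degree G v = countTrue (adj G v)

Regular : ∀ {n} → Graph n → Set
Regular {n} G = ∃ λ (d : ℕ) → ∀ (v : Fin n) → degree G v ≡ d

induced : ∀ {n k} (G : Graph n) (f : Fin k → Fin n) → Graph k
induced G f = record
  { adj = λ i j → adj G (f i) (f j)
  ; sym = λ i j → sym G (f i) (f j)
  ; irrefl = λ i → irrefl G (f i)
  }

HasInducedRegular : ∀ {n} → ℕ → Graph n → Set
HasInducedRegular {n} k G =
  Σ (Fin k → Fin n) λ f → Injective _≡_ _≡_ f × Regular (induced G f)

Forces : ℕ → ℕ → Set
Forces k n = ∀ (G : Graph n) → HasInducedRegular k G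

IsNEq : ℕ → ℕ → Set
IsNEq k N = (1 ≤ N) × Forces k N × (∀ m → 1 ≤ m → Forces k m → N ≤ m)

module Submission where

-- For p ≥ 7 let G be the disjoint union of p copies of K₂, p − 2 copies of K₄ and the
-- complete multipartite graph with 3 parts of size 2p − 1, p − 4 of size p − 1, p of size 3
-- and 2p of size 1; it has p² + 12p − 7 vertices.  An induced d-regular subgraph with T
-- vertices in the multipartite graph meets every clique in 0 or d + 1 vertices and every part
-- in 0 or r = T − d vertices.  So 4p = α(d + 1) + T and T = t·r, where α ≤ #{cliques with
-- at least d + 1 vertices} and t ≤ #{parts with at least r vertices}.  If α = 0, then t·r = 4p
-- and primality of p leaves only (t, r) ∈ {(1,4p), (2,2p), (4,p), (p,4), (2p,2), (4p,1)}, each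
-- needing more large parts than G has.  If α > 0, then T ≤ 2d (T ≤ 2p − 1 when d = 0, as then
-- t ≤ 1) and G has too few large cliques.  So N₌(4p) > |G|.

open import Defs hiding (sym)
open import Data.Bool using (Bool; true; false; if_then_else_; _∧_; _∨_; not)
open import Data.Bool.Properties using (∧-comm; ∧-identityʳ)
open import Data.Empty using (⊥; ⊥-elim)
open import Data.Fin using (Fin; zero; suc; _↑ˡ_; _↑ʳ_; splitAt; inject≤)
open import Data.Fin.Properties using (_≟_; suc-injective; splitAt-↑ˡ; splitAt-↑ʳ; inject≤-injective)
open import Data.List using (List; []; _∷_; [_]; _++_; length; lookup; map; replicate)
open import Data.List.Properties using (map-++)
open import Data.List.Relation.Unary.All using (All; []; _∷_)
open import Data.Nat using (ℕ; zero; suc; _+_; _*_; _∸_; _≤_; _≰_; _<_; _≤?_; z≤n; s≤s)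
open import Data.Nat.Divisibility using (_∣_; divides; ∣⇒≤; _∣?_)
open import Data.Nat.ListAction using (sum)
open import Data.Nat.ListAction.Properties using (sum-++)
open import Data.Nat.Primality using (Prime; euclidsLemma; prime⇒nonZero)
open import Data.Nat.Properties hiding (_≟_; suc-injective)
open import Data.Nat.Tactic.RingSolver using (solve)
open import Data.Product using (∃; _×_; _,_; proj₁; proj₂)
open import Data.Sum using (_⊎_; inj₁; inj₂; [_,_]′)
open import Function using (_∘_)
open import Function.Definitions using (Injective)
open import Relation.Binary.PropositionalEquality using (_≡_; refl; sym; trans; cong; cong₂; subst; module ≡-Reasoning)
open import Relation.Nullary using (does; yes; no)
open import Relation.Nullary.Decidable using (dec-true; dec-false; from-no)

countTrue-cong : ∀ {n} {f g : Fin n → Bool} → (∀ i → f i ≡ g i) → countTrue f ≡ countTrue g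
countTrue-cong {zero} f≗g = refl
countTrue-cong {suc n} f≗g = cong₂ _+_ (cong (λ b → if b then 1 else 0) (f≗g zero)) (countTrue-cong (f≗g ∘ suc))

countTrue-false : ∀ n → countTrue {n} (λ _ → false) ≡ 0
countTrue-false zero = refl
countTrue-false (suc n) = countTrue-false n

countTrue-true : ∀ n → countTrue {n} (λ _ → true) ≡ n
countTrue-true zero = refl
countTrue-true (suc n) = cong suc (countTrue-true n)

countTrue-const-∧ : ∀ {n} b (f : Fin n → Bool) → countTrue (λ i → b ∧ f i) ≡ (if b then countTrue f else 0)
countTrue-const-∧ true f = refl
countTrue-const-∧ {n} false f = countTrue-false n

countTrue-≤ : ∀ {n} (f : Fin n → Bool) → countTrue f ≤ n
countTrue-≤ {zero} f = z≤n
countTrue-≤ {suc n} f with f zero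
... | true = s≤s (countTrue-≤ (f ∘ suc))
... | false = m≤n⇒m≤1+n (countTrue-≤ (f ∘ suc))

countTrue-witness : ∀ {n} (f : Fin n → Bool) → 0 < countTrue f → ∃ λ i → f i ≡ true
countTrue-witness {suc n} f pos with f zero in f₀
... | true = zero , f₀
... | false with i , fi ← countTrue-witness (f ∘ suc) pos = suc i , fi

countTrue-split : ∀ {n} (f g : Fin n → Bool) →
  countTrue f ≡ countTrue (λ i → g i ∧ f i) + countTrue (λ i → not (g i) ∧ f i)
countTrue-split {zero} f g = refl
countTrue-split {suc n} f g with g zero | f zero | countTrue-split (f ∘ suc) (g ∘ suc)
... | true  | true  | ih = cong suc ih
... | true  | false | ih = ih
... | false | true  | ih = trans (cong suc ih) (sym (+-suc _ _))
... | false | false | ih = ih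

countTrue-single : ∀ {n} v (f : Fin n → Bool) → countTrue (λ w → does (v ≟ w) ∧ f w) ≡ (if f v then 1 else 0)
countTrue-single {suc n} zero f = trans (cong ((if f zero then 1 else 0) +_) (countTrue-false n)) (+-identityʳ _)
countTrue-single {suc n} (suc v) f = countTrue-single v (f ∘ suc)

countTrue-+ : ∀ m {n} (f : Fin (m + n) → Bool) →
  countTrue f ≡ countTrue (f ∘ (_↑ˡ n)) + countTrue (f ∘ (m ↑ʳ_))
countTrue-+ zero f = refl
countTrue-+ (suc m) f =
  trans (cong ((if f zero then 1 else 0) +_) (countTrue-+ m (f ∘ suc))) (sym (+-assoc (if f zero then 1 else 0) _ _))

image : ∀ {k n} → (Fin k → Fin n) → Fin n → Bool
image {zero} f w = false
image {suc k} f w = does (f zero ≟ w) ∨ image (f ∘ suc) w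

image-sound : ∀ {k n} (f : Fin k → Fin n) {w} → image f w ≡ true → ∃ λ i → f i ≡ w
image-sound {suc k} f {w} fw with f zero ≟ w
... | yes f₀≡w = zero , f₀≡w
... | no _ with i , fi≡w ← image-sound (f ∘ suc) fw = suc i , fi≡w

countTrue-∘-injective : ∀ {k n} {f : Fin k → Fin n} → Injective _≡_ _≡_ f → (g : Fin n → Bool) →
  countTrue (g ∘ f) ≡ countTrue (λ w → image f w ∧ g w)
countTrue-∘-injective {zero} {n} _ g = sym (countTrue-false n)
countTrue-∘-injective {suc k} {f = f} inj g = begin
  countTrue (g ∘ f)
    ≡⟨ cong₂ _+_ (sym (countTrue-single (f zero) g)) (countTrue-∘-injective (suc-injective ∘ inj) g) ⟩
  countTrue (λ w → is-f₀ w ∧ g w) + countTrue (λ w → image (f ∘ suc) w ∧ g w)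
    ≡⟨ cong₂ _+_ (countTrue-cong at-f₀) (countTrue-cong elsewhere) ⟨
  countTrue (λ w → is-f₀ w ∧ g-on-image w) + countTrue (λ w → not (is-f₀ w) ∧ g-on-image w)
    ≡⟨ countTrue-split g-on-image is-f₀ ⟨
  countTrue g-on-image ∎
  where
  open ≡-Reasoning
  is-f₀ g-on-image : Fin _ → Bool
  is-f₀ w = does (f zero ≟ w)
  g-on-image w = image f w ∧ g w
  at-f₀ : ∀ w → is-f₀ w ∧ g-on-image w ≡ is-f₀ w ∧ g w
  at-f₀ w with f zero ≟ w
  ... | yes _ = refl
  ... | no _ = refl
  elsewhere : ∀ w → not (is-f₀ w) ∧ g-on-image w ≡ image (f ∘ suc) w ∧ g w
  elsewhere w with f zero ≟ w
  ... | no _ = refl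
  ... | yes refl with image (f ∘ suc) (f zero) in f₀∈f[suc]
  ...   | false = refl
  ...   | true with i , fi≡f₀ ← image-sound (f ∘ suc) f₀∈f[suc] with () ← inj fi≡f₀

-- A block graph has one vertex set per block: clique blocks induce cliques with no edges
-- leaving them, and the part blocks are the parts of a single complete multipartite graph.
data Kind : Set where
  clique part : Kind

_is_ : Kind → Kind → Bool
clique is clique = true
part is part = true
_ is _ = false

Block : Set
Block = Kind × ℕ

order : List Block → ℕ
order L = sum (map proj₂ L)

blockOf : ∀ L → Fin (order L) → Fin (length L)
blockOf ((_ , s) ∷ L) v = [ (λ _ → zero) , suc ∘ blockOf L ]′ (splitAt s v)

blockOf-↑ˡ : ∀ k s L i → blockOf ((k , s) ∷ L) (i ↑ˡ order L) ≡ zero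
blockOf-↑ˡ k s L i rewrite splitAt-↑ˡ s i (order L) = refl

blockOf-↑ʳ : ∀ k s L j → blockOf ((k , s) ∷ L) (s ↑ʳ j) ≡ suc (blockOf L j)
blockOf-↑ʳ k s L j rewrite splitAt-↑ʳ s (order L) j = refl

kindOf : ∀ L → Fin (order L) → Kind
kindOf L v = proj₁ (lookup L (blockOf L v))

kindOf-↑ˡ : ∀ k s L i → kindOf ((k , s) ∷ L) (i ↑ˡ order L) ≡ k
kindOf-↑ˡ k s L i = cong (proj₁ ∘ lookup ((k , s) ∷ L)) (blockOf-↑ˡ k s L i)

kindOf-↑ʳ : ∀ k s L j → kindOf ((k , s) ∷ L) (s ↑ʳ j) ≡ kindOf L j
kindOf-↑ʳ k s L j = cong (proj₁ ∘ lookup ((k , s) ∷ L)) (blockOf-↑ʳ k s L j)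

sameBlock : ∀ L → Fin (order L) → Fin (order L) → Bool
sameBlock L v w = does (blockOf L v ≟ blockOf L w)

adjacent : ∀ L → Fin (order L) → Fin (order L) → Bool
adjacent L v w =
  if sameBlock L v w
  then not (does (v ≟ w)) ∧ (kindOf L v is clique)
  else (kindOf L v is part) ∧ (kindOf L w is part)

adjacent-sym : ∀ L v w → adjacent L v w ≡ adjacent L w v
adjacent-sym L v w with blockOf L v ≟ blockOf L w | blockOf L w ≟ blockOf L v | v ≟ w | w ≟ v
... | yes _  | yes _  | yes _   | yes _   = refl
... | yes b≡ | yes _  | no _    | no _    = cong (λ b → proj₁ (lookup L b) is clique) b≡
... | yes _  | yes _  | yes v≡w | no w≢v  = ⊥-elim (w≢v (sym v≡w))
... | yes _  | yes _  | no v≢w  | yes w≡v = ⊥-elim (v≢w (sym w≡v))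
... | no _   | no _   | _       | _       = ∧-comm (kindOf L v is part) (kindOf L w is part)
... | yes b≡ | no b≢  | _       | _       = ⊥-elim (b≢ (sym b≡))
... | no b≢  | yes b≡ | _       | _       = ⊥-elim (b≢ (sym b≡))

adjacent-irrefl : ∀ L v → adjacent L v v ≡ false
adjacent-irrefl L v rewrite dec-true (blockOf L v ≟ blockOf L v) refl | dec-true (v ≟ v) refl = refl

blockGraph : ∀ L → Graph (order L)
blockGraph L = record { adj = adjacent L ; sym = adjacent-sym L ; irrefl = adjacent-irrefl L }

module _ (L : List Block) (S : Fin (order L) → Bool) where

  occupancy : Fin (length L) → ℕ
  occupancy b = countTrue (λ w → does (b ≟ blockOf L w) ∧ S w)

  partOccupancy : ℕ
  partOccupancy = countTrue (λ w → (kindOf L w is part) ∧ S w)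

  degreeIn : Fin (order L) → ℕ
  degreeIn v = countTrue (λ w → adjacent L v w ∧ S w)

  occupancy-clique : ∀ v → S v ≡ true → kindOf L v ≡ clique → occupancy (blockOf L v) ≡ suc (degreeIn v)
  occupancy-clique v Sv kv = begin
    occupancy (blockOf L v)
      ≡⟨ countTrue-split in-block (λ w → does (v ≟ w)) ⟩
    countTrue (λ w → does (v ≟ w) ∧ in-block w) + countTrue (λ w → not (does (v ≟ w)) ∧ in-block w)
      ≡⟨ cong₂ _+_ (countTrue-single v in-block) (countTrue-cong neighbour) ⟩
    (if in-block v then 1 else 0) + degreeIn v
      ≡⟨ cong (λ b → (if b then 1 else 0) + degreeIn v) v-in-block ⟩
    suc (degreeIn v) ∎
    where
    open ≡-Reasoning
    in-block : Fin (order L) → Bool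
    in-block w = sameBlock L v w ∧ S w
    v-in-block : in-block v ≡ true
    v-in-block rewrite dec-true (blockOf L v ≟ blockOf L v) refl = Sv
    neighbour : ∀ w → not (does (v ≟ w)) ∧ in-block w ≡ adjacent L v w ∧ S w
    neighbour w rewrite kv with blockOf L v ≟ blockOf L w | v ≟ w
    ... | yes _ | yes _ = refl
    ... | yes _ | no _ = refl
    ... | no _ | yes _ = refl
    ... | no _ | no _ = refl

  occupancy-part : ∀ v → kindOf L v ≡ part → occupancy (blockOf L v) + degreeIn v ≡ partOccupancy
  occupancy-part v kv = begin
    occupancy (blockOf L v) + degreeIn v
      ≡⟨ cong₂ _+_ (countTrue-cong same-block) (countTrue-cong other-block) ⟨
    countTrue (λ w → sameBlock L v w ∧ in-part w) + countTrue (λ w → not (sameBlock L v w) ∧ in-part w)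
      ≡⟨ countTrue-split in-part (sameBlock L v) ⟨
    partOccupancy ∎
    where
    open ≡-Reasoning
    in-part : Fin (order L) → Bool
    in-part w = (kindOf L w is part) ∧ S w
    same-block : ∀ w → sameBlock L v w ∧ in-part w ≡ sameBlock L v w ∧ S w
    same-block w with blockOf L v ≟ blockOf L w
    ... | no _ = refl
    ... | yes b≡ rewrite sym (cong (proj₁ ∘ lookup L) b≡) | kv = refl
    other-block : ∀ w → not (sameBlock L v w) ∧ in-part w ≡ adjacent L v w ∧ S w
    other-block w rewrite kv with blockOf L v ≟ blockOf L w
    ... | no _ = refl
    ... | yes _ with v ≟ w
    ...   | yes _ = refl
    ...   | no _ = refl

regularOccupancy : ℕ → ℕ → Kind → ℕ
regularOccupancy d T clique = suc d
regularOccupancy d T part = T ∸ d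

-- A vertex of S in block b (the other cases contradict the witness) fixes the occupancy of b
-- through its degree.
occupancy-regular : ∀ L S d → (∀ v → S v ≡ true → degreeIn L S v ≡ d) →
  ∀ b → occupancy L S b ≡ 0 ⊎ occupancy L S b ≡ regularOccupancy d (partOccupancy L S) (proj₁ (lookup L b))
occupancy-regular L S d regular b
  with occupancy L S b in occ≡ | countTrue-witness (λ w → does (b ≟ blockOf L w) ∧ S w)
... | zero  | _ = inj₁ refl
... | suc c | witness with w , _ ← witness (s≤s z≤n) with b ≟ blockOf L w | S w in Sw
... | yes refl | true = inj₂ (by-kind (kindOf L w) refl)
  where
  by-kind : ∀ k → kindOf L w ≡ k → suc c ≡ regularOccupancy d (partOccupancy L S) k
  by-kind clique kw = trans (sym occ≡) (trans (occupancy-clique L S w Sw kw) (cong suc (regular w Sw)))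
  by-kind part kw = trans (sym (m+n∸n≡m (suc c) d))
    (cong (_∸ d) (trans (cong₂ _+_ (sym occ≡) (sym (regular w Sw))) (occupancy-part L S w kw)))

profile : ∀ L → (Fin (order L) → Bool) → List (Block × ℕ)
profile [] S = []
profile ((k , s) ∷ L) S = ((k , s) , countTrue (S ∘ (_↑ˡ order L))) ∷ profile L (S ∘ (s ↑ʳ_))

map-proj₁-profile : ∀ L S → map proj₁ (profile L S) ≡ L
map-proj₁-profile [] S = refl
map-proj₁-profile (B ∷ L) S = cong (B ∷_) (map-proj₁-profile L _)

occupancy-zero : ∀ k s L S → occupancy ((k , s) ∷ L) S zero ≡ countTrue (S ∘ (_↑ˡ order L))
occupancy-zero k s L S = trans (countTrue-+ s _) (trans (cong₂ _+_
  (countTrue-cong (λ i → cong (λ c → does (zero ≟ c) ∧ S (i ↑ˡ order L)) (blockOf-↑ˡ k s L i)))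
  (trans (countTrue-cong (λ j → cong (λ c → does (zero ≟ c) ∧ S (s ↑ʳ j)) (blockOf-↑ʳ k s L j)))
         (countTrue-false (order L))))
  (+-identityʳ _))

occupancy-suc : ∀ k s L S b → occupancy ((k , s) ∷ L) S (suc b) ≡ occupancy L (S ∘ (s ↑ʳ_)) b
occupancy-suc k s L S b = trans (countTrue-+ s _) (cong₂ _+_
  (trans (countTrue-cong (λ i → cong (λ c → does (suc b ≟ c) ∧ S (i ↑ˡ order L)) (blockOf-↑ˡ k s L i)))
         (countTrue-false s))
  (countTrue-cong (λ j → cong (λ c → does (suc b ≟ c) ∧ S (s ↑ʳ j)) (blockOf-↑ʳ k s L j))))

Admissible : ℕ → ℕ → Block × ℕ → Set
Admissible d T ((k , s) , c) = c ≤ s × (c ≡ 0 ⊎ c ≡ regularOccupancy d T k)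

profile-admissible : ∀ {d T} L S →
  (∀ b → occupancy L S b ≡ 0 ⊎ occupancy L S b ≡ regularOccupancy d T (proj₁ (lookup L b))) →
  All (Admissible d T) (profile L S)
profile-admissible [] S occupancies = []
profile-admissible {d} {T} ((k , s) ∷ L) S occupancies =
  (countTrue-≤ _ , subst (λ c → c ≡ 0 ⊎ c ≡ regularOccupancy d T k) (occupancy-zero k s L S) (occupancies zero))
  ∷ profile-admissible L (S ∘ (s ↑ʳ_))
      (λ b → subst (λ c → c ≡ 0 ⊎ c ≡ _) (occupancy-suc k s L S b) (occupancies (suc b)))

total : Kind → List (Block × ℕ) → ℕ
total k [] = 0
total k (((k′ , _) , c) ∷ xs) = (if k′ is k then c else 0) + total k xs

countTrue-kind : ∀ L S k → countTrue (λ w → (kindOf L w is k) ∧ S w) ≡ total k (profile L S)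
countTrue-kind [] S k = refl
countTrue-kind ((k′ , s) ∷ L) S k = trans (countTrue-+ s _) (cong₂ _+_
  (trans (countTrue-cong (λ i → cong (λ k″ → (k″ is k) ∧ S (i ↑ˡ order L)) (kindOf-↑ˡ k′ s L i)))
         (countTrue-const-∧ (k′ is k) (S ∘ (_↑ˡ order L))))
  (trans (countTrue-cong (λ j → cong (λ k″ → (k″ is k) ∧ S (s ↑ʳ j)) (kindOf-↑ʳ k′ s L j)))
         (countTrue-kind L (S ∘ (s ↑ʳ_)) k)))

countTrue-profile : ∀ L S → countTrue S ≡ total clique (profile L S) + total part (profile L S)
countTrue-profile L S = trans (countTrue-split S (λ w → kindOf L w is clique))
  (cong₂ _+_ (countTrue-kind L S clique)
    (trans (countTrue-cong (λ w → cong (_∧ S w) (not-is-clique (kindOf L w)))) (countTrue-kind L S part)))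
  where
  not-is-clique : ∀ k → not (k is clique) ≡ k is part
  not-is-clique clique = refl
  not-is-clique part = refl

atLeast : Kind → ℕ → List Block → ℕ
atLeast k e [] = 0
atLeast k e ((k′ , s) ∷ L) = (if (k′ is k) ∧ does (e ≤? s) then 1 else 0) + atLeast k e L

total-regular-step : ∀ {r c s tot a} → c ≤ s → c ≡ 0 ⊎ c ≡ r → (∃ λ t → tot ≡ t * r × t ≤ a) →
  ∃ λ t → c + tot ≡ t * r × t ≤ (if does (r ≤? s) then 1 else 0) + a
total-regular-step _ (inj₁ refl) (t , tot≡ , t≤) = t , tot≡ , m≤n⇒m≤o+n _ t≤
total-regular-step c≤s (inj₂ refl) (t , tot≡ , t≤) rewrite dec-true (_ ≤? _) c≤s =
  suc t , cong (_ +_) tot≡ , s≤s t≤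

total-regular : ∀ {d T} k xs → All (Admissible d T) xs →
  ∃ λ t → total k xs ≡ t * regularOccupancy d T k × t ≤ atLeast k (regularOccupancy d T k) (map proj₁ xs)
total-regular k [] [] = 0 , refl , z≤n
total-regular clique (((part , _) , _) ∷ xs) (_ ∷ adm) = total-regular clique xs adm
total-regular part (((clique , _) , _) ∷ xs) (_ ∷ adm) = total-regular part xs adm
total-regular clique (((clique , _) , _) ∷ xs) ((c≤s , c∈) ∷ adm) =
  total-regular-step c≤s c∈ (total-regular clique xs adm)
total-regular part (((part , _) , _) ∷ xs) ((c≤s , c∈) ∷ adm) =
  total-regular-step c≤s c∈ (total-regular part xs adm)

record RegularShape (L : List Block) (n d : ℕ) : Set where
  constructor shape
  field
    cliques parts partVertices : ℕ
    vertices : cliques * suc d + partVertices ≡ n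
    partition : partVertices ≡ parts * (partVertices ∸ d)
    cliques≤ : cliques ≤ atLeast clique (suc d) L
    parts≤ : parts ≤ atLeast part (partVertices ∸ d) L

profile-shape : ∀ {n d} xs → All (Admissible d (total part xs)) xs →
  total clique xs + total part xs ≡ n → RegularShape (map proj₁ xs) n d
profile-shape xs adm size
  with α , cliques≡ , α≤ ← total-regular clique xs adm
     | t , parts≡ , t≤ ← total-regular part xs adm
  = shape α t (total part xs) (trans (cong (_+ total part xs) (sym cliques≡)) size) parts≡ α≤ t≤

regular-shape : ∀ L {n} → HasInducedRegular n (blockGraph L) → ∃ λ d → RegularShape L n d
regular-shape L {n} (f , f-inj , d , f-regular) =
  d , subst (λ L′ → RegularShape L′ n d) (map-proj₁-profile L S) (profile-shape (profile L S) admissible size)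
  where
  S = image f
  S-regular : ∀ v → S v ≡ true → degreeIn L S v ≡ d
  S-regular v Sv with i , refl ← image-sound f Sv =
    trans (countTrue-cong (λ w → ∧-comm (adjacent L (f i) w) (S w)))
          (trans (sym (countTrue-∘-injective f-inj (adjacent L (f i)))) (f-regular i))
  admissible : All (Admissible d (total part (profile L S))) (profile L S)
  admissible = subst (λ T → All (Admissible d T) (profile L S)) (countTrue-kind L S part)
    (profile-admissible L S (occupancy-regular L S d S-regular))
  size : total clique (profile L S) + total part (profile L S) ≡ n
  size = begin
    total clique (profile L S) + total part (profile L S) ≡⟨ countTrue-profile L S ⟨
    countTrue S                                            ≡⟨ countTrue-cong (λ w → sym (∧-identityʳ (S w))) ⟩
    countTrue (λ w → S w ∧ true)                           ≡⟨ countTrue-∘-injective f-inj (λ _ → true) ⟨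
    countTrue {n} (λ _ → true)                             ≡⟨ countTrue-true n ⟩
    n                                                      ∎
    where open ≡-Reasoning

atLeast-++ : ∀ k e L L′ → atLeast k e (L ++ L′) ≡ atLeast k e L + atLeast k e L′
atLeast-++ k e [] L′ = refl
atLeast-++ k e ((k′ , s) ∷ L) L′ =
  trans (cong (_ +_) (atLeast-++ k e L L′)) (sym (+-assoc (if (k′ is k) ∧ does (e ≤? s) then 1 else 0) _ _))

atLeast-replicate : ∀ k e n k′ s →
  atLeast k e (replicate n (k′ , s)) ≡ (if (k′ is k) ∧ does (e ≤? s) then n else 0)
atLeast-replicate k e zero k′ s with (k′ is k) ∧ does (e ≤? s)
... | true = refl
... | false = refl
atLeast-replicate k e (suc n) k′ s with (k′ is k) ∧ does (e ≤? s) | atLeast-replicate k e n k′ s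
... | true | ih = cong suc ih
... | false | ih = ih

expand : List (ℕ × Block) → List Block
expand [] = []
expand ((n , B) ∷ σ) = replicate n B ++ expand σ

multiplicityAtLeast : Kind → ℕ → ℕ × Block → ℕ
multiplicityAtLeast k e (n , (k′ , s)) = if (k′ is k) ∧ does (e ≤? s) then n else 0

atLeast-expand : ∀ k e σ → atLeast k e (expand σ) ≡ sum (map (multiplicityAtLeast k e) σ)
atLeast-expand k e [] = refl
atLeast-expand k e ((n , (k′ , s)) ∷ σ) =
  trans (atLeast-++ k e (replicate n (k′ , s)) _)
    (cong₂ _+_ (atLeast-replicate k e n k′ s) (atLeast-expand k e σ))

order-expand : ∀ σ → order (expand σ) ≡ sum (map (λ (n , (_ , s)) → n * s) σ)
order-expand [] = refl
order-expand ((n , (k , s)) ∷ σ) =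
  trans (cong sum (map-++ proj₂ (replicate n (k , s)) (expand σ)))
    (trans (sum-++ (map proj₂ (replicate n (k , s))) _) (cong₂ _+_ (order-replicate n) (order-expand σ)))
  where
  order-replicate : ∀ n → order (replicate n (k , s)) ≡ n * s
  order-replicate zero = refl
  order-replicate (suc n) = cong (s +_) (order-replicate n)

data FactorsOf4 : ℕ → ℕ → Set where
  1×4 : FactorsOf4 1 4
  2×2 : FactorsOf4 2 2
  4×1 : FactorsOf4 4 1

factorsOf4 : ∀ x y → x * y ≡ 4 → FactorsOf4 x y
factorsOf4 x y xy≡4 = by-x x y xy≡4 (divides y (trans (sym xy≡4) (*-comm x y)))
  where
  by-x : ∀ x y → x * y ≡ 4 → x ∣ 4 → FactorsOf4 x y
  by-x 1 y e _ with refl ← trans (sym (+-identityʳ y)) e = 1×4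
  by-x 2 y e _ with refl ← *-cancelˡ-≡ y 2 2 e = 2×2
  by-x 3 y e 3∣4 = ⊥-elim (from-no (3 ∣? 4) 3∣4)
  by-x 4 y e _ with refl ← *-cancelˡ-≡ y 1 4 e = 4×1
  by-x (suc (suc (suc (suc (suc _))))) y e x∣4 with s≤s (s≤s (s≤s (s≤s ()))) ← ∣⇒≤ x∣4

factor-4p : ∀ {p} → Prime p → ∀ t r → t * r ≡ 4 * p →
  (∃ λ m → t ≡ m * p × m * r ≡ 4) ⊎ (∃ λ m → r ≡ m * p × t * m ≡ 4)
factor-4p {p} p-prime t r tr≡4p = by-divisor (euclidsLemma t r p-prime (divides 4 tr≡4p))
  where
  open ≡-Reasoning
  cancel : ∀ x → x * p ≡ 4 * p → x ≡ 4
  cancel x = *-cancelʳ-≡ x 4 p {{prime⇒nonZero p-prime}}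
  by-divisor : p ∣ t ⊎ p ∣ r → (∃ λ m → t ≡ m * p × m * r ≡ 4) ⊎ (∃ λ m → r ≡ m * p × t * m ≡ 4)
  by-divisor (inj₁ (divides m t≡mp)) = inj₁ (m , t≡mp , cancel (m * r) (begin
    m * r * p   ≡⟨ *-assoc m r p ⟩
    m * (r * p) ≡⟨ cong (m *_) (*-comm r p) ⟩
    m * (p * r) ≡⟨ *-assoc m p r ⟨
    m * p * r   ≡⟨ cong (_* r) t≡mp ⟨
    t * r       ≡⟨ tr≡4p ⟩
    4 * p       ∎))
  by-divisor (inj₂ (divides m r≡mp)) = inj₂ (m , r≡mp , cancel (t * m) (begin
    t * m * p   ≡⟨ *-assoc t m p ⟩
    t * (m * p) ≡⟨ cong (t *_) r≡mp ⟨
    t * r       ≡⟨ tr≡4p ⟩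
    4 * p       ∎))

-- With r = T ∸ (d + 1): t = 1 forces T = 0, and t ≥ 2 gives 2r ≤ T ≤ d + 1 + r.
partition-bound : ∀ d T t → T ≡ t * (T ∸ suc d) → T ≤ suc d + suc d
partition-bound d T zero T≡0 = ≤-trans (≤-reflexive T≡0) z≤n
partition-bound d zero (suc t) _ = z≤n
partition-bound d (suc T) 1 T≡ =
  ⊥-elim (1+n≰n (≤-trans (≤-reflexive (trans T≡ (+-identityʳ _))) (m∸n≤m T d)))
partition-bound d T (suc (suc t)) T≡ = ≤-trans T≤e+r (+-monoʳ-≤ (suc d) r≤e)
  where
  r = T ∸ suc d
  T≤e+r : T ≤ suc d + r
  T≤e+r = m≤n+m∸n T (suc d)
  r≤e : r ≤ suc d
  r≤e = +-cancelʳ-≤ r r (suc d) (begin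
    r + r           ≤⟨ +-monoʳ-≤ r (m≤m+n r (t * r)) ⟩
    r + (r + t * r) ≡⟨ T≡ ⟨
    T               ≤⟨ T≤e+r ⟩
    suc d + r       ∎)
    where open ≤-Reasoning

≰-by-gap : ∀ {m n} → m ≤ n → ∀ k → suc n + k ≡ m → ⊥
≰-by-gap m≤n k gap = <⇒≱ (≤-trans (m≤m+n _ k) (≤-reflexive gap)) m≤n

vertex-bound : ∀ {α c d T B n} → α * suc d + T ≡ n → α ≤ c → T ≤ B → n ≤ c * suc d + B
vertex-bound {d = d} refl α≤c T≤B = +-mono-≤ (*-monoˡ-≤ (suc d) α≤c) T≤B

if-≤ : ∀ b n → (if b then n else 0) ≤ n
if-≤ true n = ≤-refl
if-≤ false n = z≤n

if-below : ∀ {e s} n → s < e → (if does (e ≤? s) then n else 0) ≡ 0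
if-below {e} {s} n s<e rewrite dec-false (e ≤? s) (<⇒≱ s<e) = refl

-- p = 7 + q
module _ (q : ℕ) where

  blocks : List (ℕ × Block)
  blocks = (7 + q , clique , 2) ∷ (5 + q , clique , 4)
    ∷ (3 , part , 13 + 2 * q) ∷ (3 + q , part , 6 + q) ∷ (7 + q , part , 3) ∷ (14 + 2 * q , part , 1) ∷ []

  counterexample : List Block
  counterexample = expand blocks

  order-counterexample : (7 + q) * (7 + q) + 11 * (7 + q) ≤ order counterexample
  order-counterexample = ≤-trans (m≤m+n _ q) (≤-reflexive (begin
    (7 + q) * (7 + q) + 11 * (7 + q) + q
      ≡⟨ solve [ q ] ⟩
    (7 + q) * 2 + ((5 + q) * 4 + (3 * (13 + 2 * q) + ((3 + q) * (6 + q) + ((7 + q) * 3 + ((14 + 2 * q) * 1 + 0)))))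
      ≡⟨ order-expand blocks ⟨
    order counterexample ∎))
    where open ≡-Reasoning

  parts≥p : atLeast part (7 + q) counterexample ≤ 3
  parts≥p = ≤-trans (≤-reflexive (atLeast-expand part (7 + q) blocks))
    (+-mono-≤ (if-≤ (does (7 + q ≤? 13 + 2 * q)) 3)
              (≤-reflexive (cong (_+ 0) (if-below (3 + q) (n<1+n (6 + q))))))

  parts≥2p : ∀ e → 14 + 2 * q ≤ e → atLeast part e counterexample ≡ 0
  parts≥2p e big = trans (atLeast-expand part e blocks)
    (cong₂ _+_ (if-below 3 big)
    (cong₂ _+_ (if-below (3 + q) (≤-trans 7+q≤14+2q big))
    (cong₂ _+_ (if-below (7 + q) (≤-trans (m≤m+n 4 _) big))
    (cong (_+ 0) (if-below (14 + 2 * q) (≤-trans (m≤m+n 2 _) big))))))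
    where
    7+q≤14+2q : 7 + q ≤ 14 + 2 * q
    7+q≤14+2q = ≤-trans (m≤m+n (7 + q) (7 + q)) (≤-reflexive (solve [ q ]))

  single-part-bound : ∀ t T → T ≡ t * T → t ≤ atLeast part T counterexample → T ≤ 13 + 2 * q
  single-part-bound t T T≡tT t≤ with 14 + 2 * q ≤? T
  ... | no small = ≤-pred (≰⇒> small)
  ... | yes big with refl ← n≤0⇒n≡0 (≤-trans t≤ (≤-reflexive (parts≥2p T big))) =
    ≤-trans (≤-reflexive T≡tT) z≤n

  no-equipartite-4p : Prime (7 + q) → ∀ t r →
    t * r ≡ 4 * (7 + q) → t ≤ atLeast part r counterexample → ⊥
  no-equipartite-4p p-prime t r tr≡4p t≤ with factor-4p p-prime t r tr≡4p
  ... | inj₁ (m , refl , mr≡4) with factorsOf4 m r mr≡4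
  ...   | 1×4 = ≰-by-gap (≤-trans t≤ (≤-reflexive parts≥4)) 0 (solve [ q ])
    where
    parts≥4 : atLeast part 4 counterexample ≡ 3 + ((3 + q) + 0)
    parts≥4 = atLeast-expand part 4 blocks
  ...   | 2×2 = ≰-by-gap (≤-trans t≤ (≤-reflexive parts≥2)) 0 (solve [ q ])
    where
    parts≥2 : atLeast part 2 counterexample ≡ 3 + ((3 + q) + ((7 + q) + 0))
    parts≥2 = atLeast-expand part 2 blocks
  ...   | 4×1 = ≰-by-gap (≤-trans t≤ (≤-reflexive parts≥1)) 0 (solve [ q ])
    where
    parts≥1 : atLeast part 1 counterexample ≡ 3 + ((3 + q) + ((7 + q) + ((14 + 2 * q) + 0)))
    parts≥1 = atLeast-expand part 1 blocks
  no-equipartite-4p p-prime t r tr≡4p t≤ | inj₂ (m , refl , tm≡4) with factorsOf4 t m tm≡4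
  ...   | 1×4 = 1+n≰n (≤-trans t≤ (≤-reflexive (parts≥2p (4 * (7 + q)) 14+2q≤4p)))
    where
    14+2q≤4p : 14 + 2 * q ≤ 4 * (7 + q)
    14+2q≤4p = ≤-trans (m≤m+n _ (14 + 2 * q)) (≤-reflexive (solve [ q ]))
  ...   | 2×2 = 1+n≰n (≤-trans (s≤s z≤n) (≤-trans t≤ (≤-reflexive (parts≥2p (2 * (7 + q)) 14+2q≤2p))))
    where
    14+2q≤2p : 14 + 2 * q ≤ 2 * (7 + q)
    14+2q≤2p = ≤-reflexive (solve [ q ])
  ...   | 4×1 = 1+n≰n (≤-trans t≤ (subst (λ e → atLeast part e counterexample ≤ 3) (sym (*-identityˡ (7 + q))) parts≥p))

  few-cliques : ∀ d {α T} → suc α ≤ atLeast clique (2 + d) counterexample → T ≤ suc d + suc d →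
    suc α * (2 + d) + T ≡ 4 * (7 + q) → ⊥
  few-cliques 0 α≤ T≤ vertices =
    ≰-by-gap (vertex-bound vertices (≤-trans α≤ (≤-reflexive cliques≥2)) T≤) 1 (solve [ q ])
    where
    cliques≥2 : atLeast clique 2 counterexample ≡ (7 + q) + ((5 + q) + 0)
    cliques≥2 = atLeast-expand clique 2 blocks
  few-cliques 1 α≤ T≤ vertices =
    ≰-by-gap (vertex-bound vertices (≤-trans α≤ (≤-reflexive cliques≥3)) T≤) (8 + q) (solve [ q ])
    where
    cliques≥3 : atLeast clique 3 counterexample ≡ (5 + q) + 0
    cliques≥3 = atLeast-expand clique 3 blocks
  few-cliques 2 α≤ T≤ vertices =
    ≰-by-gap (vertex-bound vertices (≤-trans α≤ (≤-reflexive cliques≥4)) T≤) 1 (solve [ q ])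
    where
    cliques≥4 : atLeast clique 4 counterexample ≡ (5 + q) + 0
    cliques≥4 = atLeast-expand clique 4 blocks
  few-cliques (suc (suc (suc d))) α≤ _ _
    with () ← ≤-trans α≤ (≤-reflexive (atLeast-expand clique (5 + d) blocks))

  no-regular-shape : Prime (7 + q) → ∀ d → RegularShape counterexample (4 * (7 + q)) d → ⊥
  no-regular-shape p-prime d (shape zero t T vertices partition _ t≤) =
    no-equipartite-4p p-prime t (T ∸ d) (trans (sym partition) vertices) t≤
  no-regular-shape _ zero (shape (suc α) t T vertices partition α≤ t≤) =
    ≰-by-gap (vertex-bound vertices (≤-trans α≤ (≤-reflexive cliques≥1)) (single-part-bound t T partition t≤))
      2 (solve [ q ])
    where
    cliques≥1 : atLeast clique 1 counterexample ≡ (7 + q) + ((5 + q) + 0)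
    cliques≥1 = atLeast-expand clique 1 blocks
  no-regular-shape _ (suc d) (shape (suc α) t T vertices partition α≤ _) =
    few-cliques d α≤ (partition-bound d T t partition) vertices

Forces-mono : ∀ {k m n} → m ≤ n → Forces k m → Forces k n
Forces-mono m≤n forces G with f , f-inj , regular ← forces (induced G (λ i → inject≤ i m≤n)) =
  (λ i → inject≤ (f i) m≤n) , (λ e → f-inj (inject≤-injective m≤n m≤n _ _ e)) , regular

theorem9 : ∀ (p : ℕ) → Prime p → 7 ≤ p →
    ∀ (N : ℕ) → IsNEq (4 * p) N → (p * p + 11 * p) ∸ 1 ≤ N
theorem9 p p-prime 7≤p N (_ , forces , _) with q , refl ← m≤n⇒∃[o]m+o≡n 7≤p =
  ≤-trans (m∸n≤m _ 1) (≤-trans (order-counterexample q) (<⇒≤ (≰⇒> too-small)))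
  where
  too-small : N ≰ order (counterexample q)
  too-small N≤ with d , sh ← regular-shape _ (Forces-mono N≤ forces (blockGraph (counterexample q))) =
    no-regular-shape q p-prime d sh
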